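{- Let $0<n<\omega$. The forcing $Q^n$ has the pure decision property: given a $Q^n$-name $\tau$ and $p\in Q^n$ with $p\Vdash_{Q^n}\tau\in\{0,1\}$, there exist $q\in Q^n$ and $i\in\{0,1\}$ such that $q\le^0 p$ and $q\Vdash_{Q^n}\tau=i$.
   Context: For an infinite $\bar A\subseteq\omega$ with increasing enumeration $\langle k_j:j<\omega\rangle$ let $\bar A_i=\{k_j: j\equiv i \bmod n\}$ for $i<n$; for finite $w\subseteq\omega$ with increasing enumeration $\langle l_j:j<m\rangle$ let $w_i=\{l_j:j\equiv i\bmod n\}$. The conditions of $Q^n$ are pairs $(w,\bar A)\in[\omega]^{<\omega}\times[\omega]^\omega$, and $(w,\bar A)\le(v,\bar B)$ iff $w\cap(\max(v)+1)=v$, and for every $i<n$, $w_i\setminus v_i\subseteq\bar B_i$ and $\bar A_i\subseteq \bar B_i$. For $p=(w,\bar A)$ write $w^p=w$; $q\le^0 p$ means $q\le p$ and $w^q=w^p$. -}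

module Defs where

open import Level using (0ℓ)
open import Data.Nat using (ℕ; zero; suc; _≤_; _<_; NonZero)
open import Data.Nat.DivMod using (_%_)
open import Data.Fin using (Fin; toℕ)
open import Data.List using (List; length; lookup)
open import Data.List.Relation.Unary.Linked using (Linked)
open import Data.Product using (Σ; ∃; _×_; _,_)
open import Relation.Binary.PropositionalEquality using (_≡_)
open import Relation.Nullary using (¬_)

module Q (n : ℕ) {{nz : NonZero n}} where

  -- A condition (w , Ā): w a finite subset of ω given by its increasing
  -- enumeration ⟨l_j : j < m⟩ (a strictly increasing list), Ā an infinite
  -- subset of ω given by its increasing enumeration ⟨k_j : j < ω⟩.
  record Cond : Set where
    constructor mkCond
    field
      w    : List ℕ
      wInc : Linked _<_ w
      A    : ℕ → ℕ
      AInc : ∀ j → A j < A (suc j)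
  open Cond public

  _∈fin[_]_ : ℕ → ℕ → List ℕ → Set
  x ∈fin[ i ] v = Σ (Fin (length v)) λ j → (toℕ j % n ≡ i) × (lookup v j ≡ x)

  _∈inf[_]_ : ℕ → ℕ → (ℕ → ℕ) → Set
  x ∈inf[ i ] B = Σ ℕ λ j → (j % n ≡ i) × (B j ≡ x)

  _∈fin_ : ℕ → List ℕ → Set
  x ∈fin v = Σ (Fin (length v)) λ j → lookup v j ≡ x

  -- w ∩ (max(v)+1) = v, with the convention max(∅)+1 = 0;
  -- "x < max(v)+1" is written "x ≤ y for some y ∈ v".
  EndExt : List ℕ → List ℕ → Set
  EndExt w v = ∀ x → ((x ∈fin w × Σ ℕ λ y → (y ∈fin v) × (x ≤ y)) → x ∈fin v)
                   × (x ∈fin v → (x ∈fin w × Σ ℕ λ y → (y ∈fin v) × (x ≤ y)))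

  _≤Q_ : Cond → Cond → Set
  q ≤Q p = EndExt (w q) (w p)
         × (∀ i → i < n →
              (∀ x → x ∈fin[ i ] w q → ¬ (x ∈fin[ i ] w p) → x ∈inf[ i ] A p)
            × (∀ x → x ∈inf[ i ] A q → x ∈inf[ i ] A p))

  _≤⁰_ : Cond → Cond → Set
  q ≤⁰ p = (q ≤Q p) × (w q ≡ w p)

  Compatible : Cond → Cond → Set
  Compatible a b = ∃ λ r → (r ≤Q a) × (r ≤Q b)

  -- A (nice) Q^n-name for a subset of ω: for each k a set of conditions N k;
  -- its evaluation is τ[G] = { k | G ∩ N k ≠ ∅ }.  Every name for an element
  -- of {0,1} = {∅,{0}} is forced equal to such a name.
  Name : Set₁
  Name = ℕ → Cond → Set

  _⊩_∈τ_ : Cond → ℕ → Name → Set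
  q ⊩ k ∈τ τ = ∀ r → r ≤Q q → ∃ λ a → τ k a × Compatible r a

  _⊩_∉τ_ : Cond → ℕ → Name → Set
  q ⊩ k ∉τ τ = ∀ a → τ k a → ¬ Compatible q a

  -- q ⊩ τ = m, m read as the von Neumann ordinal {0,…,m-1}
  _⊩_≡τ_ : Cond → Name → ℕ → Set
  q ⊩ τ ≡τ m = ∀ k → (k < m → q ⊩ k ∈τ τ) × (m ≤ k → q ⊩ k ∉τ τ)

  -- p ⊩ τ ∈ {0,1} = {∅,{0}}, i.e. p ⊩ τ ⊆ {0}
  _⊩τ∈2_ : Cond → Name → Set
  p ⊩τ∈2 τ = ∀ k → 1 ≤ k → p ⊩ k ∉τ τ

-- Let p = (w, A) and say that a finite u can be decided inside C if (w ++ u, B) decides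
-- 0 ∈ τ for some B classwise included in C; since p ⊩ τ ⊆ {0}, this decides τ.  A fusion
-- argument yields C ⊆ A such that for every stem u drawn from C, if u can be decided inside
-- C at all then a tail of C decides it.  If u cannot be decided inside C, only boundedly
-- many x ∈ C make u ++ [x] decidable: otherwise unboundedly many are decided the same way
-- by tails of C, and interleaving these tails gives a single B deciding u.  A second fusion
-- thins C to D whose entries exceed these bounds for all stems drawn from earlier entries.
-- Were the empty stem not decidable inside C, take r ≤ (w, D) deciding τ: every prefix of
-- its new stem entries, which come from D, stays undecidable, yet r decides the whole stem.
-- So a tail of C decides the empty stem, and (w, tail) is the required q ≤⁰ p.

module Submission where

open import Defs
open import Level using (0ℓ)
open import Axiom.ExcludedMiddle using (ExcludedMiddle)
open import Data.Empty using (⊥; ⊥-elim)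
open import Data.Nat
open import Data.Nat.Properties
open import Data.Nat.DivMod
open import Data.Nat.ListAction using (sum)
open import Data.Fin using (Fin; toℕ) renaming (zero to fzero; suc to fsuc)
open import Data.Product hiding (map)
open import Data.Sum using (_⊎_; inj₁; inj₂)
open import Data.List using (List; []; _∷_; _++_; [_]; length; lookup; map; applyUpTo)
open import Data.List.Properties using (length-++; ++-assoc; ++-identityʳ)
open import Data.List.Reverse using (Reverse; []; _∶_∶ʳ_; reverseView)
open import Data.List.Membership.Propositional using (_∈_)
open import Data.List.Membership.Propositional.Properties
  using (∈-++⁺ˡ; ∈-++⁺ʳ; ∈-++⁻; ∈-map⁺; ∈-lookup; ∈-applyUpTo⁺)
open import Data.List.Relation.Unary.All as All using (All; []; _∷_)
import Data.List.Relation.Unary.All.Properties as All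
open import Data.List.Relation.Unary.Any using (here; there; index)
open import Data.List.Relation.Unary.Any.Properties using (lookup-index)
open import Data.List.Relation.Unary.AllPairs using (AllPairs; []; _∷_)
import Data.List.Relation.Unary.AllPairs.Properties as AllPairs
open import Data.List.Relation.Unary.Linked using (Linked)
open import Data.List.Relation.Unary.Linked.Properties using (Linked⇒AllPairs; AllPairs⇒Linked)
open import Relation.Binary.PropositionalEquality hiding ([_])
open import Relation.Nullary
open import Relation.Binary.Definitions using (tri<; tri≈; tri>)

private
  variable
    i j k x y : ℕ
    s t u v : List ℕ

Sorted : List ℕ → Set
Sorted = AllPairs _<_

Linked⇒Sorted : Linked _<_ v → Sorted v
Linked⇒Sorted = Linked⇒AllPairs <-trans

Sorted⇒Linked : Sorted v → Linked _<_ v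
Sorted⇒Linked = AllPairs⇒Linked

Sorted-++⁻ : ∀ s → Sorted (s ++ t) →
             Sorted s × Sorted t × (∀ {x y} → x ∈ s → y ∈ t → x < y)
Sorted-++⁻ []      st          = [] , st , λ ()
Sorted-++⁻ (a ∷ s) (a<st ∷ st) with Sorted-++⁻ s st
... | ss , tt , s<t = All.++⁻ˡ s a<st ∷ ss , tt , a∷s<t
  where
  a∷s<t : x ∈ a ∷ s → y ∈ _ → x < y
  a∷s<t (here refl) y∈t = All.lookup (All.++⁻ʳ s a<st) y∈t
  a∷s<t (there x∈s) y∈t = s<t x∈s y∈t

Sorted-++⁺ : Sorted s → Sorted t → (∀ {x y} → x ∈ s → y ∈ t → x < y) → Sorted (s ++ t)
Sorted-++⁺ ss st s<t = AllPairs.++⁺ ss st (All.tabulate λ x∈s → All.tabulate (s<t x∈s))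

end-extension⇒prefix : Sorted u → Sorted s → (∀ {x} → x ∈ s → x ∈ u) →
         (∀ {x y} → x ∈ u → y ∈ s → x ≤ y → x ∈ s) → ∃ λ t → u ≡ s ++ t
end-extension⇒prefix {u} {[]} _ _ _ _ = u , refl
end-extension⇒prefix {[]} {h ∷ s} _ _ s⊆u _ with s⊆u (here refl)
... | ()
end-extension⇒prefix {h′ ∷ u} {h ∷ s} (h′<u ∷ su) (h<s ∷ ss) s⊆u closed with heads
  where
  heads : h′ ≡ h
  heads with s⊆u (here refl)
  ... | here h≡h′ = sym h≡h′
  ... | there h∈u with closed (here refl) (here refl) (<⇒≤ (All.lookup h′<u h∈u))
  ...   | here h′≡h = h′≡h
  ...   | there h′∈s = ⊥-elim (<-asym (All.lookup h′<u h∈u) (All.lookup h<s h′∈s))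
... | refl = map₂ (cong (h ∷_)) (end-extension⇒prefix su ss s⊆u′ closed′)
  where
  s⊆u′ : x ∈ s → x ∈ u
  s⊆u′ x∈s with s⊆u (there x∈s)
  ... | here refl = ⊥-elim (<-irrefl refl (All.lookup h<s x∈s))
  ... | there x∈u = x∈u
  closed′ : x ∈ u → y ∈ s → x ≤ y → x ∈ s
  closed′ x∈u y∈s x≤y with closed (there x∈u) (there y∈s) x≤y
  ... | here refl = ⊥-elim (<-irrefl refl (All.lookup h′<u x∈u))
  ... | there x∈s = x∈s

_[_]=_ : List ℕ → ℕ → ℕ → Set
[]      [ p     ]= x = ⊥
(a ∷ v) [ zero  ]= x = a ≡ x
(a ∷ v) [ suc p ]= x = v [ p ]= x

lookup⇒[]= : ∀ v (j : Fin (length v)) → lookup v j ≡ x → v [ toℕ j ]= x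
lookup⇒[]= (a ∷ v) fzero    eq = eq
lookup⇒[]= (a ∷ v) (fsuc j) eq = lookup⇒[]= v j eq

[]=⇒lookup : ∀ v p → v [ p ]= x → Σ (Fin (length v)) λ j → toℕ j ≡ p × lookup v j ≡ x
[]=⇒lookup (a ∷ v) zero    eq = fzero , refl , eq
[]=⇒lookup (a ∷ v) (suc p) eq with []=⇒lookup v p eq
... | j , refl , eq′ = fsuc j , refl , eq′

[]=⇒∈ : ∀ v p → v [ p ]= x → x ∈ v
[]=⇒∈ (a ∷ v) zero    refl = here refl
[]=⇒∈ (a ∷ v) (suc p) eq   = there ([]=⇒∈ v p eq)

∈⇒[]= : x ∈ v → ∃ λ p → v [ p ]= x
∈⇒[]= (here refl)  = 0 , refl
∈⇒[]= (there x∈v) with ∈⇒[]= x∈v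
... | p , at-p = suc p , at-p

[]=-++⁺ˡ : ∀ s p → s [ p ]= x → (s ++ t) [ p ]= x
[]=-++⁺ˡ (a ∷ s) zero    eq = eq
[]=-++⁺ˡ (a ∷ s) (suc p) eq = []=-++⁺ˡ s p eq

[]=-++⁺ʳ : ∀ s p → t [ p ]= x → (s ++ t) [ length s + p ]= x
[]=-++⁺ʳ []      p eq = eq
[]=-++⁺ʳ (a ∷ s) p eq = []=-++⁺ʳ s p eq

[]=-++⁻ : ∀ s p → (s ++ t) [ p ]= x →
          (p < length s × s [ p ]= x) ⊎ (∃ λ q → p ≡ length s + q × t [ q ]= x)
[]=-++⁻ []      p       eq = inj₂ (p , refl , eq)
[]=-++⁻ (a ∷ s) zero    eq = inj₁ (s≤s z≤n , eq)
[]=-++⁻ (a ∷ s) (suc p) eq with []=-++⁻ s p eq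
... | inj₁ (p<s , eq′)      = inj₁ (s≤s p<s , eq′)
... | inj₂ (q , refl , eq′) = inj₂ (q , refl , eq′)

∈⇒≤sum : x ∈ v → x ≤ sum v
∈⇒≤sum {v = a ∷ v} (here refl) = m≤m+n a (sum v)
∈⇒≤sum {v = a ∷ v} (there x∈v) = ≤-trans (∈⇒≤sum x∈v) (m≤n+m (sum v) a)

sublists : List ℕ → List (List ℕ)
sublists []      = [ [] ]
sublists (a ∷ l) = map (a ∷_) (sublists l) ++ sublists l

⊆⇒∈sublists : ∀ {l} → Sorted l → Sorted u → (∀ {x} → x ∈ u → x ∈ l) → u ∈ sublists l
⊆⇒∈sublists {[]}    {l = []}    _ _ _ = here refl
⊆⇒∈sublists {b ∷ u} {l = []}    _ _ u⊆l with u⊆l (here refl)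
... | ()
⊆⇒∈sublists {[]}    {l = a ∷ l} (_ ∷ sl) _ _ =
  ∈-++⁺ʳ (map (a ∷_) (sublists l)) (⊆⇒∈sublists sl [] λ ())
⊆⇒∈sublists {b ∷ u} {l = a ∷ l} (a<l ∷ sl) (b<u ∷ su) u⊆l with u⊆l (here refl)
... | here refl = ∈-++⁺ˡ (∈-map⁺ (a ∷_) (⊆⇒∈sublists sl su tail⊆l))
  where
  tail⊆l : x ∈ u → x ∈ l
  tail⊆l x∈u with u⊆l (there x∈u)
  ... | here refl = ⊥-elim (<-irrefl refl (All.lookup b<u x∈u))
  ... | there x∈l = x∈l
... | there b∈l = ∈-++⁺ʳ (map (a ∷_) (sublists l)) (⊆⇒∈sublists sl (b<u ∷ su) b∷u⊆l)
  where
  b∷u⊆l : x ∈ b ∷ u → x ∈ l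
  b∷u⊆l x∈bu with u⊆l x∈bu | x∈bu
  ... | there x∈l | _          = x∈l
  ... | here refl | here refl  = ⊥-elim (<-irrefl refl (All.lookup a<l b∈l))
  ... | here refl | there x∈u  = ⊥-elim (<-asym (All.lookup a<l b∈l) (All.lookup b<u x∈u))

Increasing : (ℕ → ℕ) → Set
Increasing f = ∀ j → f j < f (suc j)

module _ {f : ℕ → ℕ} (f-inc : Increasing f) where

  inc-mono-< : i < j → f i < f j
  inc-mono-< {i} {suc j} (s≤s i≤j) with m≤n⇒m<n∨m≡n i≤j
  ... | inj₁ i<j  = <-trans (inc-mono-< i<j) (f-inc j)
  ... | inj₂ refl = f-inc j

  inc-mono-≤ : i ≤ j → f i ≤ f j
  inc-mono-≤ i≤j with m≤n⇒m<n∨m≡n i≤j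
  ... | inj₁ i<j  = <⇒≤ (inc-mono-< i<j)
  ... | inj₂ refl = ≤-refl

  inc-cancel-< : f i < f j → i < j
  inc-cancel-< {i} {j} fi<fj with <-cmp i j
  ... | tri< i<j _ _  = i<j
  ... | tri≈ _ refl _ = ⊥-elim (<-irrefl refl fi<fj)
  ... | tri> _ _ j<i  = ⊥-elim (<-asym fi<fj (inc-mono-< j<i))

  inc-≥-id : ∀ j → j ≤ f j
  inc-≥-id zero    = z≤n
  inc-≥-id (suc j) = ≤-trans (s≤s (inc-≥-id j)) (f-inc j)

Unbounded : (ℕ → Set) → Set
Unbounded P = ∀ N → ∃ λ x → N ≤ x × P x

Bounded : (ℕ → Set) → Set
Bounded P = ∃ λ N → ∀ x → P x → x < N

Unbounded-map : ∀ {P Q : ℕ → Set} → (∀ {x} → P x → Q x) → Unbounded P → Unbounded Q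
Unbounded-map P⇒Q unbounded N = map₂ (map₂ P⇒Q) (unbounded N)

module _ (lem : ExcludedMiddle 0ℓ) where

  bounded-or-unbounded : ∀ (P : ℕ → Set) → Bounded P ⊎ Unbounded P
  bounded-or-unbounded P with lem {Unbounded P}
  ... | yes unbounded = inj₂ unbounded
  ... | no  ¬unbounded with lem {∃ λ N → ¬ (∃ λ x → N ≤ x × P x)}
  ...   | yes (N , none) = inj₁ (N , λ x Px → ≰⇒> λ N≤x → none (x , N≤x , Px))
  ...   | no  ¬bound     = ⊥-elim (¬unbounded beyond)
    where
    beyond : Unbounded P
    beyond N with lem {∃ λ x → N ≤ x × P x}
    ... | yes found = found
    ... | no  none  = ⊥-elim (¬bound (N , none))

  Unbounded-⊎ : ∀ {P Q : ℕ → Set} → Unbounded (λ x → P x ⊎ Q x) → Unbounded P ⊎ Unbounded Q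
  Unbounded-⊎ {P} unbounded with bounded-or-unbounded P
  ... | inj₂ P-unbounded   = inj₁ P-unbounded
  ... | inj₁ (N₀ , below) = inj₂ Q-unbounded
    where
    Q-unbounded : Unbounded _
    Q-unbounded N with unbounded (N + N₀)
    ... | x , N+N₀≤x , inj₁ Px = ⊥-elim (<⇒≱ (below x Px) (≤-trans (m≤n+m N₀ N) N+N₀≤x))
    ... | x , N+N₀≤x , inj₂ Qx = x , ≤-trans (m≤m+n N N₀) N+N₀≤x , Qx

module PureDecision (n : ℕ) {{nz : NonZero n}} where
  open Q n

  ∈fin⇒∈ : ∀ v → x ∈fin v → x ∈ v
  ∈fin⇒∈ v (j , refl) = ∈-lookup j

  ∈⇒∈fin : x ∈ v → x ∈fin v
  ∈⇒∈fin x∈v = index x∈v , sym (lookup-index x∈v)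

  ∈fin[]⇒[]= : ∀ v → x ∈fin[ i ] v → ∃ λ p → p % n ≡ i × v [ p ]= x
  ∈fin[]⇒[]= v (j , j%n , eq) = toℕ j , j%n , lookup⇒[]= v j eq

  []=⇒∈fin[] : ∀ v p → p % n ≡ i → v [ p ]= x → x ∈fin[ i ] v
  []=⇒∈fin[] v p p%n eq with []=⇒lookup v p eq
  ... | j , refl , eq′ = j , p%n , eq′

  _⊆ᶜ_ : (ℕ → ℕ) → (ℕ → ℕ) → Set
  B ⊆ᶜ C = ∀ {i x} → x ∈inf[ i ] B → x ∈inf[ i ] C

  ⊆ᶜ-trans : ∀ {B C D} → B ⊆ᶜ C → C ⊆ᶜ D → B ⊆ᶜ D
  ⊆ᶜ-trans B⊆C C⊆D x∈B = C⊆D (B⊆C x∈B)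

  record Thinning : Set where
    field
      at         : ℕ → ℕ
      increasing : Increasing at
      at-mod     : ∀ j → at j % n ≡ j % n
  open Thinning public

  idᵗ : Thinning
  idᵗ = record { at = λ j → j ; increasing = λ j → ≤-refl ; at-mod = λ j → refl }

  _∘ᵗ_ : Thinning → Thinning → Thinning
  f ∘ᵗ g = record
    { at         = λ j → at f (at g j)
    ; increasing = λ j → inc-mono-< (increasing f) (increasing g j)
    ; at-mod     = λ j → trans (at-mod f (at g j)) (at-mod g j)
    }

  ∘-⊆ᶜ : ∀ C (g : Thinning) → (λ j → C (at g j)) ⊆ᶜ C
  ∘-⊆ᶜ C g (j , refl , refl) = at g j , at-mod g j , refl

  ∘-inc : ∀ {C} → Increasing C → (g : Thinning) → Increasing (λ j → C (at g j))
  ∘-inc C-inc g j = inc-mono-< C-inc (increasing g j)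

  -- Dropping the first K blocks of n entries keeps every entry in its residue class.
  shiftᵗ : ℕ → Thinning
  shiftᵗ K = record
    { at = λ j → j + K * n ; increasing = λ j → ≤-refl ; at-mod = λ j → [m+kn]%n≡m%n j K n }

  shift : ℕ → (ℕ → ℕ) → ℕ → ℕ
  shift K C j = C (j + K * n)

  shift-inc : ∀ K {C} → Increasing C → Increasing (shift K C)
  shift-inc K C-inc = ∘-inc C-inc (shiftᵗ K)

  shift-⊆ᶜ : ∀ K C → shift K C ⊆ᶜ C
  shift-⊆ᶜ K C = ∘-⊆ᶜ C (shiftᵗ K)

  ∈shift : ∀ K C m → K * n ≤ m → C m ∈inf[ m % n ] shift K C
  ∈shift K C m Kn≤m = m ∸ K * n , m∸Kn%n , cong C (m∸n+n≡m Kn≤m)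
    where
    m∸Kn%n : (m ∸ K * n) % n ≡ m % n
    m∸Kn%n = trans (sym ([m+kn]%n≡m%n (m ∸ K * n) K n)) (cong (_% n) (m∸n+n≡m Kn≤m))

  m≤o+m*n : ∀ j K → K ≤ j + K * n
  m≤o+m*n j K = ≤-trans (m≤m*n K n) (m≤n+m (K * n) j)

  module Positions {B C} (B-inc : Increasing B) (C-inc : Increasing C) (B⊆C : B ⊆ᶜ C) where

    private
      found : ∀ j → B j ∈inf[ j % n ] C
      found j = B⊆C (j , refl , refl)

      position : ℕ → ℕ
      position j = proj₁ (found j)

    pos-correct : ∀ j → C (position j) ≡ B j
    pos-correct j = proj₂ (proj₂ (found j))

    pos : Thinning
    pos = record
      { at         = position
      ; increasing = λ j → inc-cancel-< C-inc
                             (subst₂ _<_ (sym (pos-correct j)) (sym (pos-correct (suc j))) (B-inc j))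
      ; at-mod     = λ j → proj₁ (proj₂ (found j))
      }

  shift-mono-⊆ᶜ : ∀ K {B C} → Increasing B → Increasing C → B ⊆ᶜ C → shift K B ⊆ᶜ shift K C
  shift-mono-⊆ᶜ K {B} {C} B-inc C-inc B⊆C (j , refl , refl) =
    subst (λ m → B (j + K * n) ∈inf[ m ] shift K C) P%n
      (subst (λ z → z ∈inf[ at pos P % n ] shift K C) (pos-correct P) (∈shift K C (at pos P) Kn≤))
    where
    open Positions B-inc C-inc B⊆C
    P = j + K * n
    Kn≤ : K * n ≤ at pos P
    Kn≤ = ≤-trans (m≤n+m (K * n) j) (inc-≥-id (increasing pos) P)
    P%n : at pos P % n ≡ j % n
    P%n = trans (at-mod pos P) ([m+kn]%n≡m%n j K n)

  splice : ℕ → Thinning → Thinning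
  splice k g = record { at = spl ; increasing = spl-inc ; at-mod = spl-mod }
    where
    spl : ℕ → ℕ
    spl j with j ≤? k
    ... | yes _ = j
    ... | no  _ = at g (j + k * n)

    spl-inc : Increasing spl
    spl-inc j with j ≤? k | suc j ≤? k
    ... | yes _   | yes _   = ≤-refl
    ... | yes _   | no  _   = ≤-trans (s≤s (m≤m+n j (k * n))) (inc-≥-id (increasing g) (suc j + k * n))
    ... | no  j≰k | yes j<k = ⊥-elim (j≰k (<⇒≤ j<k))
    ... | no  _   | no  _   = increasing g (j + k * n)

    spl-mod : ∀ j → spl j % n ≡ j % n
    spl-mod j with j ≤? k
    ... | yes _ = refl
    ... | no  _ = trans (at-mod g (j + k * n)) ([m+kn]%n≡m%n j k n)

  splice-≤ : ∀ k g → j ≤ k → at (splice k g) j ≡ j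
  splice-≤ {j} k g j≤k with j ≤? k
  ... | yes _   = refl
  ... | no  j≰k = ⊥-elim (j≰k j≤k)

  splice-> : ∀ k g → ¬ j ≤ k → at (splice k g) j ≡ at g (j + k * n)
  splice-> {j} k g j≰k with j ≤? k
  ... | yes j≤k = ⊥-elim (j≰k j≤k)
  ... | no  _   = refl

  module Fusion (step : ℕ → Thinning → Thinning)
                (step-fixes : ∀ k f j → j ≤ k → at (step k f) j ≡ j) where

    stage : ℕ → Thinning
    stage zero    = idᵗ
    stage (suc k) = stage k ∘ᵗ step k (stage k)

    stage-stable : ∀ m′ {m} → j ≤ m → m ≤ m′ → at (stage m′) j ≡ at (stage m) j
    stage-stable zero    j≤m z≤n  = refl
    stage-stable {j = j} (suc m′) j≤m m≤1+m′ with m≤n⇒m<n∨m≡n m≤1+m′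
    ... | inj₂ refl        = refl
    ... | inj₁ (s≤s m≤m′) =
      trans (cong (at (stage m′)) (step-fixes m′ (stage m′) j (≤-trans j≤m m≤m′)))
            (stage-stable m′ j≤m m≤m′)

    stage-factors : ∀ m′ {m} → m ≤ m′ → ∀ j →
                    ∃ λ J → J % n ≡ j % n × j ≤ J × at (stage m′) j ≡ at (stage m) J
    stage-factors zero     z≤n    j = j , refl , ≤-refl , refl
    stage-factors (suc m′) m≤1+m′ j with m≤n⇒m<n∨m≡n m≤1+m′
    ... | inj₂ refl       = j , refl , ≤-refl , refl
    ... | inj₁ (s≤s m≤m′) with stage-factors m′ m≤m′ (at (step m′ (stage m′)) j)
    ...   | J , J%n , j′≤J , eq =
      J , trans J%n (at-mod (step m′ (stage m′)) j) ,
      ≤-trans (inc-≥-id (increasing (step m′ (stage m′))) j) j′≤J , eq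

    fusion : Thinning
    fusion = record
      { at         = λ j → at (stage (suc j)) j
      ; increasing = λ j → subst (_< at (stage (suc (suc j))) (suc j))
                                  (stage-stable (suc (suc j)) (n≤1+n j) (n≤1+n (suc j)))
                                  (increasing (stage (suc (suc j))) j)
      ; at-mod     = λ j → at-mod (stage (suc j)) j
      }

    fusion-agrees : j ≤ k → at fusion j ≡ at (stage k) j
    fusion-agrees {j} {k} j≤k =
      trans (stage-stable (suc j) ≤-refl (n≤1+n j)) (sym (stage-stable k ≤-refl j≤k))

    fusion-factors : ∀ k j → ∃ λ J → J % n ≡ j % n × j ≤ J × at fusion j ≡ at (stage (suc k)) J
    fusion-factors k j with ≤-total k j
    ... | inj₁ k≤j = stage-factors (suc j) (s≤s k≤j) j
    ... | inj₂ j≤k = j , refl , ≤-refl , fusion-agrees (m≤n⇒m≤1+n j≤k)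

    fusion-⊆ᶜ-stage : ∀ (C : ℕ → ℕ) k → (λ j → C (at fusion j)) ⊆ᶜ (λ j → C (at (stage (suc k)) j))
    fusion-⊆ᶜ-stage C k (j , refl , refl) with fusion-factors k j
    ... | J , J%n , _ , eq = J , J%n , cong C (sym eq)

  module SpreadingFusion (margin : Thinning → ℕ → ℕ) where
    open Fusion (λ k f → splice k (shiftᵗ (margin f k))) (λ k f j → splice-≤ k (shiftᵗ (margin f k))) public

    margin-below : ∀ k → margin (stage k) k ≤ at fusion (suc k)
    margin-below k with fusion-factors k (suc k)
    ... | l , _ , k<l , eq = begin
      M                                  ≤⟨ m≤o+m*n (l + k * n) M ⟩
      l + k * n + M * n                  ≤⟨ inc-≥-id (increasing (stage k)) _ ⟩
      at (stage k) (l + k * n + M * n)   ≡⟨ cong (at (stage k)) (splice-> k (shiftᵗ M) (<⇒≱ k<l)) ⟨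
      at (stage (suc k)) l               ≡⟨ eq ⟨
      at fusion (suc k)                  ∎
      where
      open ≤-Reasoning
      M = margin (stage k) k

  cond : (s : List ℕ) → Sorted s → (C : ℕ → ℕ) → Increasing C → Cond
  cond s s-sorted C C-inc = mkCond s (Sorted⇒Linked s-sorted) C C-inc

  Fits : ℕ → (ℕ → ℕ) → List ℕ → Set
  Fits m C t = ∀ k x → t [ k ]= x → x ∈inf[ (m + k) % n ] C

  InRange : (ℕ → ℕ) → List ℕ → Set
  InRange C u = ∀ {y} → y ∈ u → ∃ λ i → C i ≡ y

  Fits⇒InRange : ∀ {C} m → Fits m C v → InRange C v
  Fits⇒InRange m fits y∈v with ∈⇒[]= y∈v
  ... | k , at-k with fits k _ at-k
  ...   | i , _ , eq = i , eq

  InRange-⊆ᶜ : ∀ {B C} → B ⊆ᶜ C → InRange B v → InRange C v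
  InRange-⊆ᶜ B⊆C in-B y∈v with in-B y∈v
  ... | i , refl with B⊆C (i , refl , refl)
  ...   | j , _ , eq = j , eq

  record Extension (q p : Cond) : Set where
    field
      added      : List ℕ
      w-eq       : w q ≡ w p ++ added
      added-fits : Fits (length (w p)) (A p) added
      A-⊆ᶜ       : A q ⊆ᶜ A p

  EndExt-++ : ∀ s → Sorted (s ++ t) → EndExt (s ++ t) s
  EndExt-++ {t} s st-sorted x = restrict , extend
    where
    restrict : (x ∈fin (s ++ t) × ∃ λ y → y ∈fin s × x ≤ y) → x ∈fin s
    restrict (x∈st , y , y∈s , x≤y) with ∈-++⁻ s (∈fin⇒∈ (s ++ t) x∈st)
    ... | inj₁ x∈s = ∈⇒∈fin x∈s
    ... | inj₂ x∈t = ⊥-elim (<⇒≱ (proj₂ (proj₂ (Sorted-++⁻ s st-sorted)) (∈fin⇒∈ s y∈s) x∈t) x≤y)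

    extend : x ∈fin s → x ∈fin (s ++ t) × ∃ λ y → y ∈fin s × x ≤ y
    extend x∈s = ∈⇒∈fin (∈-++⁺ˡ (∈fin⇒∈ s x∈s)) , x , x∈s , ≤-refl

  Extension⇒≤ : ∀ q p → Extension q p → q ≤Q p
  Extension⇒≤ q p e = subst (λ u → EndExt u (w p)) (sym w-eq) (EndExt-++ (w p) st-sorted) ,
                          λ i _ → new-in-A , λ _ → A-⊆ᶜ
    where
    open Extension e
    st-sorted : Sorted (w p ++ added)
    st-sorted = subst Sorted w-eq (Linked⇒Sorted (wInc q))

    new-in-A : ∀ x → x ∈fin[ i ] w q → ¬ x ∈fin[ i ] w p → x ∈inf[ i ] A p
    new-in-A x x∈q x∉p with ∈fin[]⇒[]= (w q) x∈q
    ... | l , l%n , at-l with []=-++⁻ (w p) l (subst (λ u → u [ l ]= x) w-eq at-l)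
    ...   | inj₁ (_ , in-p)     = ⊥-elim (x∉p ([]=⇒∈fin[] (w p) l l%n in-p))
    ...   | inj₂ (k , refl , in-added) = subst (x ∈inf[_] A p) l%n (added-fits k x in-added)

  ≤⇒Extension : ∀ q p → q ≤Q p → Extension q p
  ≤⇒Extension q p (end , classes)
    with end-extension⇒prefix (Linked⇒Sorted (wInc q)) (Linked⇒Sorted (wInc p))
                (λ x∈p → ∈fin⇒∈ (w q) (proj₁ (proj₂ (end _) (∈⇒∈fin x∈p))))
                (λ x∈q y∈p x≤y → ∈fin⇒∈ (w p) (proj₁ (end _) (∈⇒∈fin x∈q , _ , ∈⇒∈fin y∈p , x≤y)))
  ... | t , w-eq = record { added = t ; w-eq = w-eq ; added-fits = fits ; A-⊆ᶜ = A⊆ }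
    where
    fits : Fits (length (w p)) (A p) t
    fits k x in-t = proj₁ (classes _ (m%n<n _ n)) x x∈q x∉p
      where
      x∈q : x ∈fin[ (length (w p) + k) % n ] w q
      x∈q = []=⇒∈fin[] (w q) _ refl (subst (λ u → u [ _ ]= x) (sym w-eq) ([]=-++⁺ʳ (w p) k in-t))
      x∉p : ¬ x ∈fin[ (length (w p) + k) % n ] w p
      x∉p x∈p with ∈fin[]⇒[]= (w p) x∈p
      ... | l , _ , in-p = <-irrefl refl
        (proj₂ (proj₂ (Sorted-++⁻ (w p) (subst Sorted w-eq (Linked⇒Sorted (wInc q)))))
               ([]=⇒∈ (w p) l in-p) ([]=⇒∈ t k in-t))

    A⊆ : A q ⊆ᶜ A p
    A⊆ {i} x∈A with i <? n
    ... | yes i<n = proj₂ (classes i i<n) _ x∈A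
    ... | no  i≮n = ⊥-elim (i≮n (subst (_< n) (proj₁ (proj₂ x∈A)) (m%n<n _ n)))

  ≤Q-trans : ∀ r q p → r ≤Q q → q ≤Q p → r ≤Q p
  ≤Q-trans r q p r≤q q≤p = Extension⇒≤ r p (record
    { added      = added e₂ ++ added e₁
    ; w-eq       = trans (w-eq e₁) (trans (cong (_++ added e₁) (w-eq e₂)) (++-assoc (w p) _ _))
    ; added-fits = fits
    ; A-⊆ᶜ       = λ x∈A → A-⊆ᶜ e₂ (A-⊆ᶜ e₁ x∈A)
    })
    where
    open Extension
    e₁ : Extension r q
    e₁ = ≤⇒Extension r q r≤q
    e₂ : Extension q p
    e₂ = ≤⇒Extension q p q≤p
    fits : Fits (length (w p)) (A p) (added e₂ ++ added e₁)
    fits k x in-t with []=-++⁻ {t = added e₁} (added e₂) k in-t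
    ... | inj₁ (_ , in₂)          = added-fits e₂ k x in₂
    ... | inj₂ (k′ , refl , in₁) = A-⊆ᶜ e₂ (subst (λ m → x ∈inf[ m % n ] A q) length-eq (added-fits e₁ k′ x in₁))
      where
      length-eq : length (w q) + k′ ≡ length (w p) + (length (added e₂) + k′)
      length-eq = trans (cong (λ u → length u + k′) (w-eq e₂))
                        (trans (cong (_+ k′) (length-++ (w p))) (+-assoc (length (w p)) _ k′))

  ≤Q-⊆ᶜ : ∀ q p → w q ≡ w p → A q ⊆ᶜ A p → q ≤Q p
  ≤Q-⊆ᶜ q p w-eq A⊆ = Extension⇒≤ q p (record
    { added = [] ; w-eq = trans w-eq (sym (++-identityʳ (w p))) ; added-fits = λ _ _ () ; A-⊆ᶜ = A⊆ })

  ≤Q-refl : ∀ q → q ≤Q q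
  ≤Q-refl q = ≤Q-⊆ᶜ q q refl (λ x∈A → x∈A)

  ≤Q-step : ∀ q p → w q ≡ w p ++ [ x ] → x ∈inf[ length (w p) % n ] A p → A q ⊆ᶜ A p → q ≤Q p
  ≤Q-step {x} q p w-eq x∈A A⊆ = Extension⇒≤ q p (record
    { added = [ x ] ; w-eq = w-eq ; added-fits = fits ; A-⊆ᶜ = A⊆ })
    where
    fits : Fits (length (w p)) (A p) [ x ]
    fits zero _ refl = subst (λ m → x ∈inf[ m % n ] A p) (sym (+-identityʳ _)) x∈A

  Compatible-≤ : ∀ r q a → r ≤Q q → Compatible r a → Compatible q a
  Compatible-≤ r q a r≤q (s , s≤r , s≤a) = s , ≤Q-trans s r q s≤r r≤q , s≤a

  module Deciding (τ : Name) where

    DecidesIn DecidesOut Decides : Cond → Set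
    DecidesIn  c = c ⊩ 0 ∈τ τ
    DecidesOut c = c ⊩ 0 ∉τ τ
    Decides    c = DecidesIn c ⊎ DecidesOut c

    Decides-≤ : ∀ q p → q ≤Q p → Decides p → Decides q
    Decides-≤ q p q≤p (inj₁ p⊩∈) = inj₁ λ r r≤q → p⊩∈ r (≤Q-trans r q p r≤q q≤p)
    Decides-≤ q p q≤p (inj₂ p⊩∉) = inj₂ λ a a∈τ q∥a → p⊩∉ a a∈τ (Compatible-≤ q p a q≤p q∥a)

    deciding-below : ExcludedMiddle 0ℓ → ∀ r → ∃ λ s → s ≤Q r × Decides s
    deciding-below lem r with lem {∃ λ a → τ 0 a × Compatible r a}
    ... | no  none = r , ≤Q-refl r , inj₂ λ a a∈τ r∥a → none (a , a∈τ , r∥a)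
    ... | yes (a , a∈τ , s , s≤r , s≤a) =
      s , s≤r , inj₁ λ r′ r′≤s → a , a∈τ , r′ , ≤Q-refl r′ , ≤Q-trans r′ s a r′≤s s≤a

    ⊩τ∈2-≤ : ∀ q p → q ≤Q p → p ⊩τ∈2 τ → q ⊩τ∈2 τ
    ⊩τ∈2-≤ q p q≤p p⊩2 k 1≤k a a∈τ q∥a = p⊩2 k 1≤k a a∈τ (Compatible-≤ q p a q≤p q∥a)

    -- As τ names a subset of {0}, deciding whether 0 ∈ τ decides τ.
    value-of-decision : ∀ q → q ⊩τ∈2 τ → Decides q → Σ (Fin 2) λ i → q ⊩ τ ≡τ toℕ i
    value-of-decision q q⊩2 (inj₁ q⊩0∈) = fsuc fzero , λ where
      zero    → (λ _ → q⊩0∈) , λ ()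
      (suc k) → (λ { (s≤s ()) }) , q⊩2 (suc k)
    value-of-decision q q⊩2 (inj₂ q⊩0∉) = fzero , λ where
      zero    → (λ ()) , λ _ → q⊩0∉
      (suc k) → (λ ()) , λ _ → q⊩2 (suc k) (s≤s z≤n)

    DenseClosed : (Cond → Set) → Set
    DenseClosed T = ∀ p → (∀ r → r ≤Q p → ∃ λ q → T q × Compatible r q) → T p

    DecidesIn-dense-closed : DenseClosed DecidesIn
    DecidesIn-dense-closed p dense r r≤p with dense r r≤p
    ... | q , q⊩∈ , r′ , r′≤r , r′≤q with q⊩∈ r′ r′≤q
    ...   | a , a∈τ , r′∥a = a , a∈τ , Compatible-≤ r′ r a r′≤r r′∥a

    DecidesOut-dense-closed : DenseClosed DecidesOut
    DecidesOut-dense-closed p dense a a∈τ (e , e≤p , e≤a) with dense e e≤p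
    ... | q , q⊩∉ , e′ , e′≤e , e′≤q = q⊩∉ a a∈τ (e′ , e′≤q , ≤Q-trans e′ e a e′≤e e≤a)

  Fixes : ℕ → Thinning → Set
  Fixes k g = ∀ j → j ≤ k → at g j ≡ j

  module Construction (lem : ExcludedMiddle 0ℓ) (τ : Name) (p : Cond) where
    open Deciding τ

    record DecisionIn (C : ℕ → ℕ) (u : List ℕ) : Set where
      field
        B       : ℕ → ℕ
        B-inc   : Increasing B
        B-⊆ᶜ    : B ⊆ᶜ C
        sorted  : Sorted (w p ++ u)
        decides : Decides (cond (w p ++ u) sorted B B-inc)

    Settled : (C : ℕ → ℕ) → Increasing C → List ℕ → Set
    Settled C C-inc u = (sorted : Sorted (w p ++ u)) → DecisionIn C u →
                        ∃ λ K → Decides (cond (w p ++ u) sorted (shift K C) (shift-inc K C-inc))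

    Decides-⊆ᶜ : ∀ (sorted sorted′ : Sorted (w p ++ u)) {B B′} (B-inc : Increasing B) (B′-inc : Increasing B′) →
                 B′ ⊆ᶜ B → Decides (cond (w p ++ u) sorted B B-inc) → Decides (cond (w p ++ u) sorted′ B′ B′-inc)
    Decides-⊆ᶜ sorted sorted′ B-inc B′-inc B′⊆B =
      Decides-≤ q r (≤Q-⊆ᶜ q r refl B′⊆B)
      where
      q = cond _ sorted′ _ B′-inc
      r = cond _ sorted _ B-inc

    DecisionIn-⊆ᶜ : ∀ {C C′} → C ⊆ᶜ C′ → DecisionIn C u → DecisionIn C′ u
    DecisionIn-⊆ᶜ C⊆C′ d = record
      { B = B ; B-inc = B-inc ; B-⊆ᶜ = ⊆ᶜ-trans B-⊆ᶜ C⊆C′ ; sorted = sorted ; decides = decides }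
      where open DecisionIn d

    Settled-⊆ᶜ : ∀ {C C′} C-inc C′-inc → C′ ⊆ᶜ C → Settled C C-inc u → Settled C′ C′-inc u
    Settled-⊆ᶜ {C = C} {C′} C-inc C′-inc C′⊆C settled sorted d
      with settled sorted (DecisionIn-⊆ᶜ C′⊆C d)
    ... | K , dec = K , Decides-⊆ᶜ sorted sorted (shift-inc K C-inc) (shift-inc K C′-inc)
                                   (shift-mono-⊆ᶜ K C′-inc C-inc C′⊆C) dec

    record Settling : Set where
      field
        C       : ℕ → ℕ
        C-inc   : Increasing C
        C-⊆ᶜ    : C ⊆ᶜ A p
        settles : ∀ u → InRange C u → Settled C C-inc u

    module _ where
      private
        A∘ : Thinning → ℕ → ℕ
        A∘ f j = A p (at f j)

        A∘-inc : ∀ f → Increasing (A∘ f)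
        A∘-inc = ∘-inc (AInc p)

        -- If some B ⊆ᶜ A∘ f decides u, keep the first k + 1 entries and continue along B:
        -- the tail beyond block k + 1 then lies inside B.
        settle-one : ∀ f k u → ∃ λ g → Fixes k g × Settled (A∘ (f ∘ᵗ g)) (A∘-inc (f ∘ᵗ g)) u
        settle-one f k u with lem {DecisionIn (A∘ f) u}
        ... | no  none = idᵗ , (λ _ _ → refl) , λ _ d → ⊥-elim (none d)
        ... | yes d    = splice k pos , (λ j → splice-≤ k pos) ,
                         λ sorted′ _ → suc k , Decides-⊆ᶜ sorted sorted′ B-inc
                                             (shift-inc (suc k) (A∘-inc (f ∘ᵗ splice k pos))) tail⊆B decides
          where
          open DecisionIn d
          open Positions B-inc (A∘-inc f) B-⊆ᶜ
          tail⊆B : shift (suc k) (A∘ (f ∘ᵗ splice k pos)) ⊆ᶜ B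
          tail⊆B (j , refl , refl) =
            l + k * n ,
            trans ([m+kn]%n≡m%n l k n) ([m+kn]%n≡m%n j (suc k) n) ,
            sym (trans (cong (A∘ f) (splice-> k pos (<⇒≱ (m≤o+m*n j (suc k))))) (pos-correct (l + k * n)))
            where l = j + suc k * n

        settle-all : ∀ f k (L : List (List ℕ)) →
                     ∃ λ g → Fixes k g × All (λ u → Settled (A∘ (f ∘ᵗ g)) (A∘-inc (f ∘ᵗ g)) u) L
        settle-all f k []      = idᵗ , (λ _ _ → refl) , []
        settle-all f k (u ∷ L) with settle-one f k u
        ... | g₁ , fixes₁ , settled₁ with settle-all (f ∘ᵗ g₁) k L
        ...   | g₂ , fixes₂ , settled₂ =
          g₁ ∘ᵗ g₂ ,
          (λ j j≤k → trans (cong (at g₁) (fixes₂ j j≤k)) (fixes₁ j j≤k)) ,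
          Settled-⊆ᶜ (A∘-inc (f ∘ᵗ g₁)) (A∘-inc (f ∘ᵗ (g₁ ∘ᵗ g₂))) (∘-⊆ᶜ (A∘ (f ∘ᵗ g₁)) g₂) settled₁ ∷ settled₂

        candidates : Thinning → ℕ → List (List ℕ)
        candidates f k = sublists (applyUpTo (A∘ f) (suc k))

        step : ℕ → Thinning → Thinning
        step k f = proj₁ (settle-all f k (candidates f k))

      settling : Settling
      settling = record { C = A∘ fusion ; C-inc = A∘-inc fusion ; C-⊆ᶜ = ∘-⊆ᶜ (A p) fusion ; settles = settles }
        where
        open Fusion step (λ k f → proj₁ (proj₂ (settle-all f k (candidates f k))))

        settles : ∀ u → InRange (A∘ fusion) u → Settled (A∘ fusion) (A∘-inc fusion) u
        settles u in-range sorted =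
          Settled-⊆ᶜ (A∘-inc (stage (suc K))) (A∘-inc fusion) (fusion-⊆ᶜ-stage (A p) K)
            (All.lookup (proj₂ (proj₂ (settle-all (stage K) K (candidates (stage K) K)))) u-candidate)
            sorted
          where
          K = sum u
          u⊆ : y ∈ u → y ∈ applyUpTo (A∘ (stage K)) (suc K)
          u⊆ y∈u with in-range y∈u
          ... | i , refl = subst (_∈ applyUpTo (A∘ (stage K)) (suc K)) (cong (A p) (sym (fusion-agrees i≤K)))
                                 (∈-applyUpTo⁺ (A∘ (stage K)) (s≤s i≤K))
            where
            i≤K : i ≤ K
            i≤K = ≤-trans (inc-≥-id (A∘-inc fusion) i) (∈⇒≤sum y∈u)
          u-candidate : u ∈ candidates (stage K) K
          u-candidate = ⊆⇒∈sublists
            (AllPairs.applyUpTo⁺₁ (A∘ (stage K)) (suc K) (λ i<j _ → inc-mono-< (A∘-inc (stage K)) i<j))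
            (proj₁ (proj₂ (Sorted-++⁻ (w p) sorted))) u⊆

    module Bounding (S : Settling) where
      open Settling S

      Viable : List ℕ → ℕ → Set
      Viable u x = x ∈inf[ length (w p ++ u) % n ] C × DecisionIn C (u ++ [ x ])

      Witness : List ℕ → (Cond → Set) → ℕ → Set
      Witness u T x =
        x ∈inf[ length (w p ++ u) % n ] C ×
        Σ (Sorted (w p ++ (u ++ [ x ]))) λ sorted → ∃ λ K →
          T (cond (w p ++ (u ++ [ x ])) sorted (shift K C) (shift-inc K C-inc))

      -- Unboundedly many witnesses of one kind are gathered into a single sequence B ⊆ᶜ C
      -- whose condition then forces the same.
      module FromWitnesses {u} (sorted : Sorted (w p ++ u)) {T : Cond → Set}
                           (T⇒Decides : ∀ {c} → T c → Decides c) (T-closed : DenseClosed T)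
                           (witnesses : Unbounded (Witness u T)) where
        L = length (w p ++ u)
        c = L % n

        Target : ℕ → ℕ → Set
        Target i E = Σ (Sorted (w p ++ (u ++ [ C i ]))) λ sorted′ → ∃ λ K → K * n ≤ E ×
                       T (cond (w p ++ (u ++ [ C i ])) sorted′ (shift K C) (shift-inc K C-inc))

        -- The b-th entry is chosen beyond position R; in class c it is a witness whose
        -- deciding tail starts no later than position reach.
        record Choice (R b : ℕ) : Set where
          field
            chosen     : ℕ
            R≤chosen   : R ≤ chosen
            chosen-mod : chosen % n ≡ b % n
            reach     : ℕ
            target    : b % n ≡ c → Target chosen reach
        open Choice

        choose : ∀ R b → Choice R b
        choose R b with b % n ≟ c
        ... | no b≢c = record
          { chosen     = b % n + R * n
          ; R≤chosen   = m≤o+m*n (b % n) R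
          ; chosen-mod = trans ([m+kn]%n≡m%n (b % n) R n) (m%n%n≡m%n b n)
          ; reach     = 0
          ; target    = λ b≡c → ⊥-elim (b≢c b≡c)
          }
        ... | yes b≡c with witnesses (C R)
        ...   | _ , CR≤x , (i , i%n , refl) , sorted′ , K , T-cond = record
          { chosen     = i
          ; R≤chosen   = ≮⇒≥ λ i<R → <⇒≱ (inc-mono-< C-inc i<R) CR≤x
          ; chosen-mod = trans i%n (sym b≡c)
          ; reach     = K * n
          ; target    = λ _ → sorted′ , K , ≤-refl , T-cond
          }

        lower : ℕ → ℕ
        choice : ∀ b → Choice (lower b) b
        lower zero    = 0
        lower (suc b) = suc (chosen (choice b)) + reach (choice b)
        choice b = choose (lower b) b

        π : Thinning
        π = record
          { at         = λ b → chosen (choice b)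
          ; increasing = λ b → ≤-trans (s≤s (m≤m+n _ _)) (R≤chosen (choice (suc b)))
          ; at-mod     = λ b → chosen-mod (choice b)
          }

        reach-below : ∀ {b b′} → b < b′ → reach (choice b) ≤ at π b′
        reach-below {b} b<b′ = ≤-trans (≤-trans (m≤n+m _ (suc (chosen (choice b)))) (R≤chosen (choice (suc b))))
                                       (inc-mono-≤ (increasing π) b<b′)

        B : ℕ → ℕ
        B b = C (at π b)

        B-inc : Increasing B
        B-inc = ∘-inc C-inc π

        B-cond : Cond
        B-cond = cond (w p ++ u) sorted B B-inc

        module TargetAt (b : ℕ) (b%n : b % n ≡ c) where
          sorted′ : Sorted (w p ++ (u ++ [ B b ]))
          sorted′ = proj₁ (target (choice b) b%n)

          K : ℕ
          K = proj₁ (proj₂ (target (choice b) b%n))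

          target-cond : Cond
          target-cond = cond (w p ++ (u ++ [ B b ])) sorted′ (shift K C) (shift-inc K C-inc)

          T-target : T target-cond
          T-target = proj₂ (proj₂ (proj₂ (target (choice b) b%n)))

          later∈ : ∀ {b′} → b < b′ → B b′ ∈inf[ b′ % n ] shift K C
          later∈ {b′} b<b′ = subst (B b′ ∈inf[_] shift K C) (at-mod π b′)
            (∈shift K C (at π b′) (≤-trans (proj₁ (proj₂ (proj₂ (target (choice b) b%n)))) (reach-below b<b′)))

          tail⊆target : ∀ {D} → Increasing D → D ⊆ᶜ B → shift (suc b) D ⊆ᶜ shift K C
          tail⊆target D-inc D⊆B (j , refl , refl) =
            subst₂ (λ y m → y ∈inf[ m ] shift K C) (pos-correct l) (trans (at-mod pos l) ([m+kn]%n≡m%n j (suc b) n))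
              (later∈ (≤-trans (m≤o+m*n j (suc b)) (inc-≥-id (increasing pos) l)))
            where
            open Positions D-inc B-inc D⊆B
            l = j + suc b * n

        stem-length : ∀ x k → length (w p ++ (u ++ [ x ])) + k ≡ L + suc k
        stem-length x k = begin
          length (w p ++ (u ++ [ x ])) + k ≡⟨ cong (λ v → length v + k) (++-assoc (w p) u [ x ]) ⟨
          length ((w p ++ u) ++ [ x ]) + k ≡⟨ cong (_+ k) (length-++ (w p ++ u)) ⟩
          L + 1 + k                        ≡⟨ +-assoc L 1 k ⟩
          L + suc k                        ∎
          where open ≡-Reasoning

        meets-proper : ∀ r x t → w r ≡ (w p ++ u) ++ (x ∷ t) → Fits L B (x ∷ t) → A r ⊆ᶜ B →
                       ∃ λ q → T q × Compatible r q
        meets-proper r _ t w-eq fits A⊆B with fits 0 _ refl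
        ... | b , b%n , refl = target-cond , T-target , r′ , ≤Q-⊆ᶜ r′ r refl (shift-⊆ᶜ (suc b) (A r)) ,
                               Extension⇒≤ r′ target-cond (record
                                 { added = t ; w-eq = w-eq′ ; added-fits = fits′ ; A-⊆ᶜ = tail⊆target (AInc r) A⊆B })
          where
          open TargetAt b (trans b%n (cong (_% n) (+-identityʳ L)))
          r′ : Cond
          r′ = mkCond (w r) (wInc r) (shift (suc b) (A r)) (shift-inc (suc b) (AInc r))

          w-eq′ : w r ≡ (w p ++ (u ++ [ B b ])) ++ t
          w-eq′ = trans w-eq (trans (sym (++-assoc (w p ++ u) [ B b ] t)) (cong (_++ t) (++-assoc (w p) u [ B b ])))

          Bb<t : All (B b <_) t
          Bb<t with proj₁ (proj₂ (Sorted-++⁻ (w p ++ u) (subst Sorted w-eq (Linked⇒Sorted (wInc r)))))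
          ... | Bb<t ∷ _ = Bb<t

          fits′ : Fits (length (w p ++ (u ++ [ B b ]))) (shift K C) t
          fits′ k y at-k with fits (suc k) y at-k
          ... | b′ , b′%n , refl =
            subst (B b′ ∈inf[_] shift K C) (trans b′%n (cong (_% n) (sym (stem-length (B b) k))))
              (later∈ (inc-cancel-< B-inc (All.lookup Bb<t ([]=⇒∈ t k at-k))))

        meets-same : ∀ r → w r ≡ (w p ++ u) ++ [] → A r ⊆ᶜ B → ∃ λ q → T q × Compatible r q
        meets-same r w-eq A⊆B = target-cond , T-target , r′ , r′≤r ,
                                ≤Q-⊆ᶜ r′ target-cond w-eq′ (tail⊆target (AInc r) A⊆B)
          where
          -- an entry of A r in class c lying above every entry of the stem of r
          l = c + suc (sum (w r)) * n
          z = A r l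
          l%n : l % n ≡ c
          l%n = trans ([m+kn]%n≡m%n c (suc (sum (w r))) n) (m%n%n≡m%n L n)

          open Positions (AInc r) B-inc A⊆B
          open TargetAt (at pos l) (trans (at-mod pos l) l%n)

          w-below-z : y ∈ w r → y < z
          w-below-z y∈w = ≤-trans (s≤s (∈⇒≤sum y∈w)) (≤-trans (m≤o+m*n c (suc (sum (w r)))) (inc-≥-id (AInc r) l))

          r′ : Cond
          r′ = cond (w r ++ [ z ]) (Sorted-++⁺ (Linked⇒Sorted (wInc r)) ([] ∷ []) λ { y∈w (here refl) → w-below-z y∈w })
                    (shift (suc (at pos l)) (A r)) (shift-inc (suc (at pos l)) (AInc r))

          r′≤r : r′ ≤Q r
          r′≤r = ≤Q-step r′ r refl
                   (l , trans l%n (cong (λ v → length v % n) (sym (trans w-eq (++-identityʳ _)))) , refl)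
                   (shift-⊆ᶜ (suc (at pos l)) (A r))

          w-eq′ : w r ++ [ z ] ≡ w p ++ (u ++ [ B (at pos l) ])
          w-eq′ = trans (cong (_++ [ z ]) (trans w-eq (++-identityʳ _)))
                        (trans (++-assoc (w p) u [ z ]) (cong (λ z → w p ++ (u ++ [ z ])) (sym (pos-correct l))))

        meets-target : ∀ r → r ≤Q B-cond → ∃ λ q → T q × Compatible r q
        meets-target r r≤B with ≤⇒Extension r B-cond r≤B
        ... | record { added = [] ; w-eq = w-eq ; A-⊆ᶜ = A⊆B } = meets-same r w-eq A⊆B
        ... | record { added = x ∷ t ; w-eq = w-eq ; added-fits = fits ; A-⊆ᶜ = A⊆B } =
          meets-proper r x t w-eq fits A⊆B

        decision : DecisionIn C u
        decision = record
          { B = B ; B-inc = B-inc ; B-⊆ᶜ = ∘-⊆ᶜ C π ; sorted = sorted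
          ; decides = T⇒Decides (T-closed B-cond meets-target) }

      bounded : ∀ u → Sorted (w p ++ u) → InRange C u → ¬ DecisionIn C u → Bounded (Viable u)
      bounded u sorted in-range undecided with bounded-or-unbounded lem (Viable u)
      ... | inj₁ bound     = bound
      ... | inj₂ unbounded with Unbounded-⊎ lem (Unbounded-map settle unbounded)
        where
        settle : ∀ {x} → Viable u x → Witness u DecidesIn x ⊎ Witness u DecidesOut x
        settle {x} (x∈C , d) with settles (u ++ [ x ]) in-range′ (DecisionIn.sorted d) d
          where
          in-range′ : InRange C (u ++ [ x ])
          in-range′ y∈ with ∈-++⁻ u y∈
          ... | inj₁ y∈u         = in-range y∈u
          ... | inj₂ (here refl) = proj₁ x∈C , proj₂ (proj₂ x∈C)
        ... | K , inj₁ dec = inj₁ (x∈C , DecisionIn.sorted d , K , dec)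
        ... | K , inj₂ dec = inj₂ (x∈C , DecisionIn.sorted d , K , dec)
      ...   | inj₁ ub = ⊥-elim (undecided (FromWitnesses.decision sorted inj₁ DecidesIn-dense-closed ub))
      ...   | inj₂ ub = ⊥-elim (undecided (FromWitnesses.decision sorted inj₂ DecidesOut-dense-closed ub))

    module Spreading (S : Settling) where
      open Settling S
      open Bounding S

      bound : List ℕ → ℕ
      bound u with lem {Bounded (Viable u)}
      ... | yes (N , _) = N
      ... | no  _       = 0

      below-bound : ∀ u → Bounded (Viable u) → ∀ x → Viable u x → x < bound u
      below-bound u bounded-u with lem {Bounded (Viable u)}
      ... | yes (_ , below) = below
      ... | no  unbounded   = ⊥-elim (unbounded bounded-u)

      -- No entry of D is viable after a stem drawn from earlier entries of D.
      record Spread : Set where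
        field
          D       : ℕ → ℕ
          D-inc   : Increasing D
          D-⊆ᶜ    : D ⊆ᶜ C
          D-above : ∀ {u j} → Sorted u → (∀ {y} → y ∈ u → ∃ λ i → i < j × D i ≡ y) → bound u ≤ D j

      module _ where
        private
          C′ : ℕ → ℕ
          C′ = shift (bound []) C

          C′∘ : Thinning → ℕ → ℕ
          C′∘ f j = C′ (at f j)

          C′∘-inc : ∀ f → Increasing (C′∘ f)
          C′∘-inc = ∘-inc (shift-inc (bound []) C-inc)

          candidates : Thinning → ℕ → List (List ℕ)
          candidates f k = sublists (applyUpTo (C′∘ f) (suc k))

          margin : Thinning → ℕ → ℕ
          margin f k = sum (map bound (candidates f k))

        spread : Spread
        spread = record
          { D = C′∘ fusion ; D-inc = C′∘-inc fusion
          ; D-⊆ᶜ = ⊆ᶜ-trans (∘-⊆ᶜ C′ fusion) (shift-⊆ᶜ (bound []) C) ; D-above = D-above }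
          where
          open SpreadingFusion margin

          C′-above : ∀ m → m ≤ C′ m
          C′-above = inc-≥-id (shift-inc (bound []) C-inc)

          D-above : ∀ {u j} → Sorted u → (∀ {y} → y ∈ u → ∃ λ i → i < j × C′∘ fusion i ≡ y) →
                    bound u ≤ C′∘ fusion j
          D-above {[]}    {zero}  _ _ = ≤-trans (m≤o+m*n (at fusion 0) (bound [])) (inc-≥-id C-inc _)
          D-above {_ ∷ _} {zero}  _ below with below (here refl)
          ... | _ , () , _
          D-above {u}     {suc k} sorted below =
            ≤-trans (∈⇒≤sum (∈-map⁺ bound u-candidate)) (≤-trans (margin-below k) (C′-above _))
            where
            u⊆ : y ∈ u → y ∈ applyUpTo (C′∘ (stage k)) (suc k)
            u⊆ y∈u with below y∈u
            ... | i , s≤s i≤k , refl = subst (_∈ applyUpTo (C′∘ (stage k)) (suc k)) (cong C′ (sym (fusion-agrees i≤k)))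
                                             (∈-applyUpTo⁺ (C′∘ (stage k)) (s≤s i≤k))
            u-candidate : u ∈ candidates (stage k) k
            u-candidate = ⊆⇒∈sublists
              (AllPairs.applyUpTo⁺₁ (C′∘ (stage k)) (suc k) (λ i<j _ → inc-mono-< (C′∘-inc (stage k)) i<j)) sorted u⊆

      open Spread spread

      undecided-along : ¬ DecisionIn C [] → Reverse v → Sorted (w p ++ v) → Fits (length (w p)) D v →
                        ¬ DecisionIn C v
      undecided-along undecided-root []              _      _    = undecided-root
      undecided-along undecided-root (v ∶ rv ∶ʳ x) sorted fits d = <⇒≱ x<bound bound≤x
        where
        sorted-v : Sorted (w p ++ v)
        sorted-v = proj₁ (Sorted-++⁻ (w p ++ v) (subst Sorted (sym (++-assoc (w p) v [ x ])) sorted))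

        v<x : y ∈ v → y < x
        v<x y∈v = proj₂ (proj₂ (Sorted-++⁻ (w p ++ v) (subst Sorted (sym (++-assoc (w p) v [ x ])) sorted)))
                    (∈-++⁺ʳ (w p) y∈v) (here refl)

        fits-v : Fits (length (w p)) D v
        fits-v k y at-k = fits k y ([]=-++⁺ˡ v k at-k)

        x∈D : x ∈inf[ (length (w p) + length v) % n ] D
        x∈D = subst (λ m → x ∈inf[ (length (w p) + m) % n ] D) (+-identityʳ _) (fits (length v + 0) x ([]=-++⁺ʳ v 0 refl))

        x<bound : x < bound v
        x<bound = below-bound v
          (bounded v sorted-v (InRange-⊆ᶜ D-⊆ᶜ (Fits⇒InRange _ fits-v)) (undecided-along undecided-root rv sorted-v fits-v))
          x (subst (λ m → x ∈inf[ m % n ] C) (sym (length-++ (w p))) (D-⊆ᶜ x∈D) , d)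

        bound≤x : bound v ≤ x
        bound≤x with x∈D
        ... | l , _ , refl = D-above (proj₁ (proj₂ (Sorted-++⁻ (w p) sorted-v))) earlier
          where
          earlier : y ∈ v → ∃ λ i → i < l × D i ≡ y
          earlier y∈v with Fits⇒InRange _ fits-v y∈v
          ... | i , refl = i , inc-cancel-< D-inc (v<x y∈v) , refl

      decision-at-root : DecisionIn C []
      decision-at-root with lem {DecisionIn C []}
      ... | yes d              = d
      ... | no  undecided-root = ⊥-elim (undecided-along undecided-root (reverseView added) sorted-added added-fits decision-added)
        where
        p′ : Cond
        p′ = mkCond (w p) (wInc p) D D-inc
        r = proj₁ (deciding-below lem p′)
        r≤p′ = proj₁ (proj₂ (deciding-below lem p′))
        e : Extension r p′
        e = ≤⇒Extension r p′ r≤p′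
        open Extension e

        sorted-added : Sorted (w p ++ added)
        sorted-added = subst Sorted w-eq (Linked⇒Sorted (wInc r))

        decision-added : DecisionIn C added
        decision-added = record
          { B = A r ; B-inc = AInc r ; B-⊆ᶜ = ⊆ᶜ-trans A-⊆ᶜ D-⊆ᶜ ; sorted = sorted-added
          ; decides = Decides-≤ r′ r (≤Q-⊆ᶜ r′ r (sym w-eq) (λ x∈A → x∈A)) (proj₂ (proj₂ (deciding-below lem p′))) }
          where
          r′ = cond (w p ++ added) sorted-added (A r) (AInc r)

    pure-decision : p ⊩τ∈2 τ → Σ Cond λ q → Σ (Fin 2) λ i → (q ≤⁰ p) × (q ⊩ τ ≡τ toℕ i)
    pure-decision p⊩2 =
      q , map₂ (λ value → (q≤p , refl) , value) (value-of-decision q (⊩τ∈2-≤ q p q≤p p⊩2) decides-q)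
      where
      open Settling settling
      root : DecisionIn C []
      root = Spreading.decision-at-root settling
      open DecisionIn root using (sorted)

      settled : ∃ λ K → Decides (cond (w p ++ []) sorted (shift K C) (shift-inc K C-inc))
      settled = settles [] (λ ()) sorted root
      K = proj₁ settled

      q q′ : Cond
      q  = mkCond (w p) (wInc p) (shift K C) (shift-inc K C-inc)
      q′ = cond (w p ++ []) sorted (shift K C) (shift-inc K C-inc)

      q≤p : q ≤Q p
      q≤p = ≤Q-⊆ᶜ q p refl (⊆ᶜ-trans (shift-⊆ᶜ K C) C-⊆ᶜ)

      decides-q : Decides q
      decides-q = Decides-≤ q q′ (≤Q-⊆ᶜ q q′ (sym (++-identityʳ (w p))) (λ x∈A → x∈A)) (proj₂ settled)

lemma1p15 : ExcludedMiddle 0ℓ → (n : ℕ) → {{nz : NonZero n}} →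
    (τ : Q.Name n) → (p : Q.Cond n) → Q._⊩τ∈2_ n p τ →
    Σ (Q.Cond n) λ q → Σ (Fin 2) λ i →
    Q._≤⁰_ n q p × Q._⊩_≡τ_ n q τ (toℕ i)
lemma1p15 lem n τ p = PureDecision.Construction.pure-decision n lem τ p
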